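{- Let $a,b,k$ be positive integers with $k>b$ and $a-b-1\ge 0$. Then $$f(k;a,b)\ge ka-1+\frac{k(a-b-1)}{b}\sum_{j=2}^{\lceil k/b\rceil-1}\frac1j,$$ where an empty sum equals $0$.
   Context: For positive integers $a,b$, the function $f(\cdot;a,b)$ on positive integers $k$ is defined recursively by: $f(k;a,b)=(k-1)(a+1)$ if $1\le k\le b$; $f(k;a,b)=ka$ if $b<k\le 2b$; and $f(k;a,b)=\left\lfloor \frac{k\,(f(k-b;a,b)+a-b)}{k-b}\right\rfloor$ if $k>2b$. -}

module Defs where

open import Data.Nat as ℕ using (ℕ; zero; suc; _∸_; _≤?_; NonZero)
open import Data.Nat.Properties using (m<n⇒0<n∸m; ≤-<-trans; m≤m+n)
open import Data.Integer as ℤ using (ℤ; +_)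
open import Data.Rational as ℚ using (ℚ; floor; 0ℚ; _/_)
open import Relation.Nullary using (yes; no)
open import Relation.Nullary.Negation using (contradiction)
open import Data.Nat.Properties using (≰⇒>)

-- Auxiliary: f with a fuel argument (fuel = k suffices when b ≥ 1, since
-- each recursive call decreases k by b ≥ 1).
-- fAux fuel a b k
fAux : ℕ → ℕ → ℕ → ℕ → ℤ
fAux zero    a b k = + 0
fAux (suc n) a b k with k ℕ.≤? b
... | yes _ = + ((k ∸ 1) ℕ.* (a ℕ.+ 1))
... | no k≰b with k ℕ.≤? (b ℕ.+ b)
...   | yes _ = + (k ℕ.* a)
...   | no k≰2b =
        floor ((((+ k) ℤ.* (fAux n a b (k ∸ b) ℤ.+ + a ℤ.- + b)) / (k ∸ b))
          {{ℕ.>-nonZero (m<n⇒0<n∸m (≰⇒> k≰b))}})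

f : ℕ → ℕ → ℕ → ℤ
f k a b = fAux k a b k

sumInv : ℕ → ℚ
sumInv zero = 0ℚ
sumInv (suc zero) = 0ℚ
sumInv (suc (suc n)) = sumInv (suc n) ℚ.+ ((+ 1) / suc (suc n))

-- Write c = a − b − 1 ≥ 0 and H_M = Σ_{j=2}^{M} 1/j. For k in the window bM < k ≤ b(M + 1) we have
-- ⌈k/b⌉ − 1 = M, and we show b·f(k) ≥ b(ka − 1) + kc·H_M by induction on M. For M = 1 this is f(k) = ka.
-- If k lies in window M + 1, then d = k − b lies in window M. Dropping the floor from the recursion gives
-- d(f(k) + 1) ≥ k(f(d) + 1 + c); inserting the bound for f(d) leaves a surplus kbc, which pays for the new
-- term kc·d/(M + 1) of the harmonic sum because d ≤ b(M + 1).

module Submission where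

open import Defs
open import Data.Nat as ℕ using (ℕ; zero; suc; _*_; _∸_; _<_; _≤_; _≤?_; z≤n; NonZero; >-nonZero; >-nonZero⁻¹)
open import Data.Nat.Properties
  using (≤-refl; ≤-trans; ≤-<-trans; <⇒≤; <⇒≱; ≰⇒>; m≤m+n; m≤m*n; +-comm; +-monoʳ-≤; +-cancelˡ-<;
         *-suc; *-identityʳ; m<n⇒0<n∸m; ∸-monoʳ-≤; ∸-monoˡ-<; m+n∸m≡n; m∸n+n≡m; m≤n+o⇒m∸n≤o)
open import Data.Integer as ℤ using (ℤ; +_; 1ℤ; ∣_∣)
import Data.Integer.Properties as ℤP
open import Data.Integer.DivMod using (a≡a%n+[a/n]*n; n%d<d; [n/d]*d≤n)
import Data.Integer.Solver as ℤS
open import Data.Rational as ℚ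
  using (ℚ; mkℚ; _/_; floor; ceiling; 0ℚ; 1ℚ; toℚᵘ; NonNegative; Positive; nonNegative; positive)
import Data.Rational.Properties as ℚP
import Data.Rational.Solver as ℚS
open import Data.Rational.Unnormalised as ℚᵘ using (mkℚᵘ; *≡*; *≤*; *<*)
import Data.Rational.Unnormalised.Properties as ℚᵘP
open import Data.Product using (_×_; _,_; ∃-syntax; uncurry)
open import Algebra.Properties.Group ℚP.+-0-group using (⁻¹-involutive)
open import Relation.Binary.PropositionalEquality
open import Relation.Nullary using (yes; no)
open import Relation.Nullary.Negation using (contradiction)

fromℤ : ℤ → ℚ
fromℤ i = i / 1

private
  toℚᵘ-fromℤ : ∀ i → toℚᵘ (fromℤ i) ℚᵘ.≃ mkℚᵘ i 0
  toℚᵘ-fromℤ i = ℚP.toℚᵘ-fromℚᵘ (mkℚᵘ i 0)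

fromℤ-homo-+ : ∀ i j → fromℤ (i ℤ.+ j) ≡ fromℤ i ℚ.+ fromℤ j
fromℤ-homo-+ i j = ℚP.toℚᵘ-injective (begin
  toℚᵘ (fromℤ (i ℤ.+ j))                 ≈⟨ toℚᵘ-fromℤ (i ℤ.+ j) ⟩
  mkℚᵘ (i ℤ.+ j) 0                       ≈⟨ *≡* (solve 2 (λ i j → (i :+ j) :* con 1ℤ
                                                              := (i :* con 1ℤ :+ j :* con 1ℤ) :* con 1ℤ) refl i j) ⟩
  mkℚᵘ i 0 ℚᵘ.+ mkℚᵘ j 0                 ≈⟨ ℚᵘP.+-cong (toℚᵘ-fromℤ i) (toℚᵘ-fromℤ j) ⟨
  toℚᵘ (fromℤ i) ℚᵘ.+ toℚᵘ (fromℤ j)     ≈⟨ ℚP.toℚᵘ-homo-+ (fromℤ i) (fromℤ j) ⟨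
  toℚᵘ (fromℤ i ℚ.+ fromℤ j)             ∎)
  where open ℚᵘP.≃-Reasoning; open ℤS.+-*-Solver

fromℤ-homo-* : ∀ i j → fromℤ (i ℤ.* j) ≡ fromℤ i ℚ.* fromℤ j
fromℤ-homo-* i j = ℚP.toℚᵘ-injective (begin
  toℚᵘ (fromℤ (i ℤ.* j))                 ≈⟨ toℚᵘ-fromℤ (i ℤ.* j) ⟩
  mkℚᵘ (i ℤ.* j) 0                       ≈⟨ *≡* refl ⟩
  mkℚᵘ i 0 ℚᵘ.* mkℚᵘ j 0                 ≈⟨ ℚᵘP.*-cong (toℚᵘ-fromℤ i) (toℚᵘ-fromℤ j) ⟨
  toℚᵘ (fromℤ i) ℚᵘ.* toℚᵘ (fromℤ j)     ≈⟨ ℚP.toℚᵘ-homo-* (fromℤ i) (fromℤ j) ⟨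
  toℚᵘ (fromℤ i ℚ.* fromℤ j)             ∎)
  where open ℚᵘP.≃-Reasoning

fromℤ-homo‿- : ∀ i → fromℤ (ℤ.- i) ≡ ℚ.- fromℤ i
fromℤ-homo‿- i = ℚP.toℚᵘ-injective (begin
  toℚᵘ (fromℤ (ℤ.- i))                   ≈⟨ toℚᵘ-fromℤ (ℤ.- i) ⟩
  mkℚᵘ (ℤ.- i) 0                         ≈⟨ ℚᵘP.-‿cong (toℚᵘ-fromℤ i) ⟨
  ℚᵘ.- toℚᵘ (fromℤ i)                    ≈⟨ ℚP.toℚᵘ-homo‿- (fromℤ i) ⟨
  toℚᵘ (ℚ.- fromℤ i)                     ∎)
  where open ℚᵘP.≃-Reasoning

fromℤ-homo-minus : ∀ i j → fromℤ (i ℤ.- j) ≡ fromℤ i ℚ.- fromℤ j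
fromℤ-homo-minus i j = trans (fromℤ-homo-+ i (ℤ.- j)) (cong (fromℤ i ℚ.+_) (fromℤ-homo‿- j))

fromℤ-mono-≤ : ∀ {i j} → i ℤ.≤ j → fromℤ i ℚ.≤ fromℤ j
fromℤ-mono-≤ {i} {j} i≤j = ℚP.toℚᵘ-cancel-≤
  (ℚᵘP.≤-respʳ-≃ (ℚᵘP.≃-sym (toℚᵘ-fromℤ j)) (ℚᵘP.≤-respˡ-≃ (ℚᵘP.≃-sym (toℚᵘ-fromℤ i))
    (*≤* (ℤP.*-monoʳ-≤-nonNeg 1ℤ i≤j))))

fromℤ-mono-< : ∀ {i j} → i ℤ.< j → fromℤ i ℚ.< fromℤ j
fromℤ-mono-< {i} {j} i<j = ℚP.toℚᵘ-cancel-<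
  (ℚᵘP.<-respʳ-≃ (ℚᵘP.≃-sym (toℚᵘ-fromℤ j)) (ℚᵘP.<-respˡ-≃ (ℚᵘP.≃-sym (toℚᵘ-fromℤ i))
    (*<* (ℤP.*-monoʳ-<-pos 1ℤ i<j))))

fromℤ-nonNeg : ∀ n → NonNegative (fromℤ (+ n))
fromℤ-nonNeg n = nonNegative (fromℤ-mono-≤ {+ 0} {+ n} (ℤ.+≤+ z≤n))

fromℤ-pos : ∀ n .{{_ : NonZero n}} → Positive (fromℤ (+ n))
fromℤ-pos n = positive (fromℤ-mono-< {+ 0} {+ n} (ℤ.+<+ (>-nonZero⁻¹ n)))

fromℤ-cancel-≤ : ∀ {i j} → fromℤ i ℚ.≤ fromℤ j → i ℤ.≤ j
fromℤ-cancel-≤ {i} {j} p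
  with ℚᵘP.≤-respʳ-≃ (toℚᵘ-fromℤ j) (ℚᵘP.≤-respˡ-≃ (toℚᵘ-fromℤ i) (ℚP.toℚᵘ-mono-≤ p))
... | *≤* i*1≤j*1 = subst₂ ℤ._≤_ (ℤP.*-identityʳ i) (ℤP.*-identityʳ j) i*1≤j*1

fromℤ-cancel-< : ∀ {i j} → fromℤ i ℚ.< fromℤ j → i ℤ.< j
fromℤ-cancel-< {i} {j} p
  with ℚᵘP.<-respʳ-≃ (toℚᵘ-fromℤ j) (ℚᵘP.<-respˡ-≃ (toℚᵘ-fromℤ i) (ℚP.toℚᵘ-mono-< p))
... | *<* i*1<j*1 = subst₂ ℤ._<_ (ℤP.*-identityʳ i) (ℤP.*-identityʳ j) i*1<j*1

n*[i/n]≡i : ∀ i n .{{_ : NonZero n}} → fromℤ (+ n) ℚ.* (i / n) ≡ fromℤ i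
n*[i/n]≡i i n@(suc n-1) = ℚP.toℚᵘ-injective (begin
  toℚᵘ (fromℤ (+ n) ℚ.* (i / n))
    ≈⟨ ℚP.toℚᵘ-homo-* (fromℤ (+ n)) (i / n) ⟩
  toℚᵘ (fromℤ (+ n)) ℚᵘ.* toℚᵘ (i / n)
    ≈⟨ ℚᵘP.*-cong (toℚᵘ-fromℤ (+ n)) (ℚP.toℚᵘ-fromℚᵘ (mkℚᵘ i n-1)) ⟩
  mkℚᵘ (+ n) 0 ℚᵘ.* mkℚᵘ i n-1
    ≈⟨ *≡* (solve 2 (λ n i → (n :* i) :* con 1ℤ := i :* (con 1ℤ :* n)) refl (+ n) i) ⟩
  mkℚᵘ i 0
    ≈⟨ toℚᵘ-fromℤ i ⟨
  toℚᵘ (fromℤ i) ∎)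
  where open ℚᵘP.≃-Reasoning; open ℤS.+-*-Solver

floor-≤ : ∀ p → fromℤ (floor p) ℚ.≤ p
floor-≤ p@(mkℚ n d-1 _) = ℚP.toℚᵘ-cancel-≤ (ℚᵘP.≤-respˡ-≃ (ℚᵘP.≃-sym (toℚᵘ-fromℤ (floor p)))
  (*≤* (subst (floor p ℤ.* d ℤ.≤_) (sym (ℤP.*-identityʳ n)) ([n/d]*d≤n n d))))
  where d = + suc d-1

<-floor+1 : ∀ p → p ℚ.< fromℤ (floor p ℤ.+ 1ℤ)
<-floor+1 p@(mkℚ n d-1 _) =
  ℚP.toℚᵘ-cancel-< (ℚᵘP.<-respʳ-≃ (ℚᵘP.≃-sym (toℚᵘ-fromℤ (floor p ℤ.+ 1ℤ))) (*<* n*1<[q+1]*d))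
  where
  d = + suc d-1
  q = floor p
  n*1<[q+1]*d : n ℤ.* 1ℤ ℤ.< (q ℤ.+ 1ℤ) ℤ.* d
  n*1<[q+1]*d = subst₂ ℤ._<_
    (trans (sym (a≡a%n+[a/n]*n n d)) (sym (ℤP.*-identityʳ n)))
    (solve 2 (λ d q → d :+ q :* d := (q :+ con 1ℤ) :* d) refl d q)
    (ℤP.+-monoˡ-< (q ℤ.* d) (ℤ.+<+ (n%d<d n d)))
    where open ℤS.+-*-Solver

≤-ceiling : ∀ p → p ℚ.≤ fromℤ (ceiling p)
≤-ceiling p@(mkℚ _ _ _) = begin
  p                           ≡⟨ ⁻¹-involutive p ⟨
  ℚ.- ℚ.- p                   ≤⟨ ℚP.neg-antimono-≤ (floor-≤ (ℚ.- p)) ⟩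
  ℚ.- fromℤ (floor (ℚ.- p))   ≡⟨ fromℤ-homo‿- (floor (ℚ.- p)) ⟨
  fromℤ (ceiling p)           ∎
  where open ℚP.≤-Reasoning

ceiling<+1 : ∀ p → fromℤ (ceiling p) ℚ.< p ℚ.+ 1ℚ
ceiling<+1 p@(mkℚ _ _ _) = begin-strict
  fromℤ (ceiling p)                    ≡⟨ fromℤ-homo‿- z ⟩
  ℚ.- fromℤ z                          ≡⟨ solve 1 (λ x → :- x := :- (x :+ con 1ℚ) :+ con 1ℚ) refl (fromℤ z) ⟩
  ℚ.- (fromℤ z ℚ.+ 1ℚ) ℚ.+ 1ℚ          ≡⟨ cong (λ t → ℚ.- t ℚ.+ 1ℚ) (fromℤ-homo-+ z 1ℤ) ⟨
  ℚ.- fromℤ (z ℤ.+ 1ℤ) ℚ.+ 1ℚ          <⟨ ℚP.+-monoˡ-< 1ℚ (ℚP.neg-antimono-< (<-floor+1 (ℚ.- p))) ⟩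
  ℚ.- ℚ.- p ℚ.+ 1ℚ                     ≡⟨ cong (ℚ._+ 1ℚ) (⁻¹-involutive p) ⟩
  p ℚ.+ 1ℚ                             ∎
  where
  open ℚP.≤-Reasoning
  open ℚS.+-*-Solver
  z = floor (ℚ.- p)

i≤n*[⌊i/n⌋+1] : ∀ i n .{{_ : NonZero n}} → fromℤ i ℚ.≤ fromℤ (+ n) ℚ.* (fromℤ (floor (i / n)) ℚ.+ 1ℚ)
i≤n*[⌊i/n⌋+1] i n = begin
  fromℤ i                          ≡⟨ n*[i/n]≡i i n ⟨
  N ℚ.* (i / n)                    ≤⟨ ℚP.*-monoˡ-≤-nonNeg N {{fromℤ-nonNeg n}} (ℚP.<⇒≤ (<-floor+1 (i / n))) ⟩
  N ℚ.* fromℤ (⌊i/n⌋ ℤ.+ 1ℤ)       ≡⟨ cong (N ℚ.*_) (fromℤ-homo-+ ⌊i/n⌋ 1ℤ) ⟩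
  N ℚ.* (fromℤ ⌊i/n⌋ ℚ.+ 1ℚ)       ∎
  where
  open ℚP.≤-Reasoning
  N = fromℤ (+ n)
  ⌊i/n⌋ = floor (i / n)

ceiling-/-bounds : ∀ i n .{{_ : NonZero n}} →
                   i ℤ.≤ + n ℤ.* ceiling (i / n) × + n ℤ.* ceiling (i / n) ℤ.< i ℤ.+ + n
ceiling-/-bounds i n = fromℤ-cancel-≤ lower , fromℤ-cancel-< upper
  where
  open ℚP.≤-Reasoning
  N = fromℤ (+ n)
  q = i / n
  lower : fromℤ i ℚ.≤ fromℤ (+ n ℤ.* ceiling q)
  lower = begin
    fromℤ i                       ≡⟨ n*[i/n]≡i i n ⟨
    N ℚ.* q                       ≤⟨ ℚP.*-monoˡ-≤-nonNeg N {{fromℤ-nonNeg n}} (≤-ceiling q) ⟩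
    N ℚ.* fromℤ (ceiling q)       ≡⟨ fromℤ-homo-* (+ n) (ceiling q) ⟨
    fromℤ (+ n ℤ.* ceiling q)     ∎
  upper : fromℤ (+ n ℤ.* ceiling q) ℚ.< fromℤ (i ℤ.+ + n)
  upper = begin-strict
    fromℤ (+ n ℤ.* ceiling q)     ≡⟨ fromℤ-homo-* (+ n) (ceiling q) ⟩
    N ℚ.* fromℤ (ceiling q)       <⟨ ℚP.*-monoʳ-<-pos N {{fromℤ-pos n}} (ceiling<+1 q) ⟩
    N ℚ.* (q ℚ.+ 1ℚ)              ≡⟨ ℚP.*-distribˡ-+ N q 1ℚ ⟩
    N ℚ.* q ℚ.+ N ℚ.* 1ℚ          ≡⟨ cong₂ ℚ._+_ (n*[i/n]≡i i n) (ℚP.*-identityʳ N) ⟩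
    fromℤ i ℚ.+ N                 ≡⟨ fromℤ-homo-+ i (+ n) ⟨
    fromℤ (i ℤ.+ + n)             ∎

fAux-zero : ∀ n a b → fAux n a b 0 ≡ + 0
fAux-zero zero    a b = refl
fAux-zero (suc n) a b with 0 ≤? b
... | yes _   = refl
... | no  0≰b = contradiction z≤n 0≰b

fAux-fuel : ∀ {a b} → 0 < b → ∀ {m n k} → k ≤ m → k ≤ n → fAux m a b k ≡ fAux n a b k
fAux-fuel {a} {b} _  {zero}  {n}     z≤n _   = sym (fAux-zero n a b)
fAux-fuel {a} {b} _  {suc m} {zero}  _   z≤n = fAux-zero (suc m) a b
fAux-fuel {a} {b} 0<b {suc m} {suc n} {k} k≤1+m k≤1+n with k ≤? b
... | yes _ = refl
... | no k≰b with k ≤? b ℕ.+ b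
...   | yes _ = refl
...   | no  _ = cong (λ x → floor (((+ k ℤ.* (x ℤ.+ + a ℤ.- + b)) / (k ∸ b)) {{nz}}))
                   (fAux-fuel 0<b (fuel-drop k≤1+m) (fuel-drop k≤1+n))
  where
  nz : NonZero (k ∸ b)
  nz = >-nonZero (m<n⇒0<n∸m (≰⇒> k≰b))
  fuel-drop : ∀ {l} → k ≤ suc l → k ∸ b ≤ l
  fuel-drop k≤1+l = ≤-trans (∸-monoʳ-≤ k 0<b) (m≤n+o⇒m∸n≤o k 1 k≤1+l)

f-middle : ∀ {a b k} → b < k → k ≤ b ℕ.+ b → f k a b ≡ + (k * a)
f-middle {a} {b} {suc k} b<k k≤2b with suc k ≤? b
... | yes k≤b = contradiction k≤b (<⇒≱ b<k)
... | no  _ with suc k ≤? b ℕ.+ b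
...   | yes _    = refl
...   | no  k≰2b = contradiction k≤2b k≰2b

f-step : ∀ {a b k} → 0 < b → b ℕ.+ b < k → .{{_ : NonZero (k ∸ b)}} →
         f k a b ≡ floor ((+ k ℤ.* (f (k ∸ b) a b ℤ.+ + a ℤ.- + b)) / (k ∸ b))
f-step {a} {b} {suc k} 0<b 2b<k with suc k ≤? b
... | yes k≤b = contradiction (≤-trans k≤b (m≤m+n b b)) (<⇒≱ 2b<k)
... | no  k≰b with suc k ≤? b ℕ.+ b
...   | yes k≤2b = contradiction k≤2b (<⇒≱ 2b<k)
...   | no  _    = cong (λ x → floor (((+ suc k ℤ.* (x ℤ.+ + a ℤ.- + b)) / (suc k ∸ b)) {{nz}}))
                        (fAux-fuel 0<b (∸-monoʳ-≤ (suc k) 0<b) ≤-refl)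
  where
  nz : NonZero (suc k ∸ b)
  nz = >-nonZero (m<n⇒0<n∸m (≰⇒> k≰b))

-- b times the bound ka − 1 + (kc/b)·H of the theorem, with A, B, C, K standing for a, b, c, k.
scaledBound : (A B C K H : ℚ) → ℚ
scaledBound A B C K H = B ℚ.* (K ℚ.* A ℚ.- 1ℚ) ℚ.+ K ℚ.* C ℚ.* H

scaledBound-zero : ∀ A B C K .{{_ : NonNegative B}} → scaledBound A B C K 0ℚ ℚ.≤ B ℚ.* (K ℚ.* A)
scaledBound-zero A B C K = begin
  scaledBound A B C K 0ℚ              ≡⟨ solve 4 (λ A B C K → B :* (K :* A :- con 1ℚ) :+ K :* C :* con 0ℚ
                                                          := B :* (K :* A) :+ :- B) refl A B C K ⟩
  B ℚ.* (K ℚ.* A) ℚ.+ ℚ.- B           ≤⟨ ℚP.+-monoʳ-≤ (B ℚ.* (K ℚ.* A)) (ℚP.neg-antimono-≤ (ℚP.nonNegative⁻¹ B)) ⟩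
  B ℚ.* (K ℚ.* A) ℚ.+ 0ℚ              ≡⟨ ℚP.+-identityʳ _ ⟩
  B ℚ.* (K ℚ.* A)                     ∎
  where open ℚP.≤-Reasoning; open ℚS.+-*-Solver

scaledBound-step : ∀ A B C D H u F F′ .{{_ : Positive D}} .{{_ : NonNegative B}} .{{_ : NonNegative C}} →
  scaledBound A B C D H ℚ.≤ B ℚ.* F′ →
  (D ℚ.+ B) ℚ.* (F′ ℚ.+ 1ℚ ℚ.+ C) ℚ.≤ D ℚ.* (F ℚ.+ 1ℚ) →
  D ℚ.* u ℚ.≤ B →
  scaledBound A B C (D ℚ.+ B) (H ℚ.+ u) ℚ.≤ B ℚ.* F
scaledBound-step A B C D H u F F′ bound′ floor-ineq Du≤B =
  ℚP.*-cancelˡ-≤-pos D (begin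
    D ℚ.* scaledBound A B C (D ℚ.+ B) (H ℚ.+ u)
      ≡⟨ solve 6 (λ A B C D H u →
           D :* (B :* ((D :+ B) :* A :- con 1ℚ) :+ (D :+ B) :* C :* (H :+ u))
           := (D :+ B) :* (B :* (D :* A :- con 1ℚ) :+ D :* C :* H) :+ (B :* B :+ (D :+ B) :* C :* (D :* u)))
           refl A B C D H u ⟩
    (D ℚ.+ B) ℚ.* scaledBound A B C D H ℚ.+ (B ℚ.* B ℚ.+ (D ℚ.+ B) ℚ.* C ℚ.* (D ℚ.* u))
      ≤⟨ ℚP.+-mono-≤ (ℚP.*-monoˡ-≤-nonNeg (D ℚ.+ B) bound′)
                     (ℚP.+-monoʳ-≤ (B ℚ.* B) (ℚP.*-monoˡ-≤-nonNeg ((D ℚ.+ B) ℚ.* C) Du≤B)) ⟩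
    (D ℚ.+ B) ℚ.* (B ℚ.* F′) ℚ.+ (B ℚ.* B ℚ.+ (D ℚ.+ B) ℚ.* C ℚ.* B)
      ≡⟨ solve 4 (λ B C D F′ →
           (D :+ B) :* (B :* F′) :+ (B :* B :+ (D :+ B) :* C :* B)
           := B :* ((D :+ B) :* (F′ :+ con 1ℚ :+ C)) :+ :- (B :* D))
           refl B C D F′ ⟩
    B ℚ.* ((D ℚ.+ B) ℚ.* (F′ ℚ.+ 1ℚ ℚ.+ C)) ℚ.+ ℚ.- (B ℚ.* D)
      ≤⟨ ℚP.+-monoˡ-≤ (ℚ.- (B ℚ.* D)) (ℚP.*-monoˡ-≤-nonNeg B floor-ineq) ⟩
    B ℚ.* (D ℚ.* (F ℚ.+ 1ℚ)) ℚ.+ ℚ.- (B ℚ.* D)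
      ≡⟨ solve 3 (λ B D F → B :* (D :* (F :+ con 1ℚ)) :+ :- (B :* D) := D :* (B :* F)) refl B D F ⟩
    D ℚ.* (B ℚ.* F) ∎)
  where
  open ℚP.≤-Reasoning
  open ℚS.+-*-Solver
  instance
    D+B≥0 : NonNegative (D ℚ.+ B)
    D+B≥0 = ℚP.nonNeg+nonNeg⇒nonNeg D {{ℚP.pos⇒nonNeg D}} B
    [D+B]C≥0 : NonNegative ((D ℚ.+ B) ℚ.* C)
    [D+B]C≥0 = ℚP.nonNeg*nonNeg⇒nonNeg (D ℚ.+ B) C

scaledBound⇒bound : ∀ A B C K E H F .{{_ : Positive B}} → B ℚ.* E ≡ K ℚ.* C →
  scaledBound A B C K H ℚ.≤ B ℚ.* F → K ℚ.* A ℚ.- 1ℚ ℚ.+ E ℚ.* H ℚ.≤ F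
scaledBound⇒bound A B C K E H F BE≡KC bound = ℚP.*-cancelˡ-≤-pos B (begin
  B ℚ.* (K ℚ.* A ℚ.- 1ℚ ℚ.+ E ℚ.* H)
    ≡⟨ solve 5 (λ A B K E H → B :* (K :* A :- con 1ℚ :+ E :* H) := B :* (K :* A :- con 1ℚ) :+ B :* E :* H)
               refl A B K E H ⟩
  B ℚ.* (K ℚ.* A ℚ.- 1ℚ) ℚ.+ B ℚ.* E ℚ.* H
    ≡⟨ cong (λ x → B ℚ.* (K ℚ.* A ℚ.- 1ℚ) ℚ.+ x ℚ.* H) BE≡KC ⟩
  scaledBound A B C K H
    ≤⟨ bound ⟩
  B ℚ.* F ∎)
  where open ℚP.≤-Reasoning; open ℚS.+-*-Solver

b*m<k∸b : ∀ {b m k} → b * suc m < k → b * m < k ∸ b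
b*m<k∸b {b} {m} {k} b[1+m]<k = subst (_< k ∸ b) (trans (cong (_∸ b) (*-suc b m)) (m+n∸m≡n b (b * m)))
  (∸-monoˡ-< b[1+m]<k (m≤m*n b (suc m)))

k∸b≤b*m : ∀ {b m k} → k ≤ b * suc m → k ∸ b ≤ b * m
k∸b≤b*m {b} {m} {k} k≤b[1+m] = m≤n+o⇒m∸n≤o k b (subst (k ≤_) (*-suc b m) k≤b[1+m])

d≤b*n⇒d*[1/n]≤b : ∀ d b n .{{_ : NonZero n}} → d ≤ b * n → fromℤ (+ d) ℚ.* (+ 1 / n) ℚ.≤ fromℤ (+ b)
d≤b*n⇒d*[1/n]≤b d b n d≤bn = begin
  fromℤ (+ d) ℚ.* (+ 1 / n)                     ≤⟨ ℚP.*-monoʳ-≤-nonNeg (+ 1 / n) {{ℚP.normalize-nonNeg 1 n}} D≤BN ⟩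
  fromℤ (+ b) ℚ.* fromℤ (+ n) ℚ.* (+ 1 / n)     ≡⟨ ℚP.*-assoc (fromℤ (+ b)) (fromℤ (+ n)) (+ 1 / n) ⟩
  fromℤ (+ b) ℚ.* (fromℤ (+ n) ℚ.* (+ 1 / n))   ≡⟨ cong (fromℤ (+ b) ℚ.*_) (n*[i/n]≡i (+ 1) n) ⟩
  fromℤ (+ b) ℚ.* 1ℚ                            ≡⟨ ℚP.*-identityʳ (fromℤ (+ b)) ⟩
  fromℤ (+ b)                                   ∎
  where
  open ℚP.≤-Reasoning
  D≤BN : fromℤ (+ d) ℚ.≤ fromℤ (+ b) ℚ.* fromℤ (+ n)
  D≤BN = subst (fromℤ (+ d) ℚ.≤_) (trans (cong fromℤ (ℤP.pos-* b n)) (fromℤ-homo-* (+ b) (+ n)))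
               (fromℤ-mono-≤ (ℤ.+≤+ d≤bn))

bounds⇒window : ∀ {b k} .{{_ : NonZero b}} c → b < k → + k ℤ.≤ + b ℤ.* c → + b ℤ.* c ℤ.< + k ℤ.+ + b →
                ∃[ m ] c ≡ + suc (suc m) × b * suc m < k × k ≤ b * suc (suc m)
bounds⇒window {suc _} ℤ.-[1+ _ ] _ ()
bounds⇒window {b} {k} (+ 0) b<k k≤0 _ =
  contradiction (ℤP.drop‿+≤+ (subst (+ k ℤ.≤_) (ℤP.*-zeroʳ (+ b)) k≤0)) (<⇒≱ (≤-<-trans z≤n b<k))
bounds⇒window {b} {k} (+ 1) b<k k≤b _ =
  contradiction (ℤP.drop‿+≤+ (subst (+ k ℤ.≤_) (ℤP.*-identityʳ (+ b)) k≤b)) (<⇒≱ b<k)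
bounds⇒window {b} {k} (+ suc (suc m)) _ k≤b[2+m] b[2+m]<k+b =
  m , refl , b[1+m]<k , ℤP.drop‿+≤+ (subst (+ k ℤ.≤_) (sym (ℤP.pos-* b (suc (suc m)))) k≤b[2+m])
  where
  b[1+m]<k : b * suc m < k
  b[1+m]<k = +-cancelˡ-< b _ _ (subst₂ _<_ (*-suc b (suc m)) (+-comm k b)
    (ℤP.drop‿+<+ (subst₂ ℤ._<_ (sym (ℤP.pos-* b (suc (suc m)))) (sym (ℤP.pos-+ k b)) b[2+m]<k+b)))

ceiling-/-window : ∀ b k .{{_ : NonZero b}} → b < k →
                   ∃[ m ] ceiling (+ k / b) ≡ + suc (suc m) × b * suc m < k × k ≤ b * suc (suc m)
ceiling-/-window b k b<k = uncurry (bounds⇒window (ceiling (+ k / b)) b<k) (ceiling-/-bounds (+ k) b)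

module _ (a b : ℕ) .{{_ : NonZero b}} (c≥0 : + 0 ℤ.≤ + a ℤ.- + b ℤ.- 1ℤ) where

  c : ℤ
  c = + a ℤ.- + b ℤ.- 1ℤ

  A B C : ℚ
  A = fromℤ (+ a)
  B = fromℤ (+ b)
  C = fromℤ c

  F : ℕ → ℚ
  F k = fromℤ (f k a b)

  f-step-≤ : ∀ k → b ℕ.+ b < k → .{{_ : NonZero (k ∸ b)}} →
             fromℤ (+ k) ℚ.* (F (k ∸ b) ℚ.+ 1ℚ ℚ.+ C) ℚ.≤ fromℤ (+ (k ∸ b)) ℚ.* (F k ℚ.+ 1ℚ)
  f-step-≤ k 2b<k = begin
    fromℤ (+ k) ℚ.* (F (k ∸ b) ℚ.+ 1ℚ ℚ.+ C)       ≡⟨ cong (fromℤ (+ k) ℚ.*_) F′+1+C≡F′+a-b ⟩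
    fromℤ (+ k) ℚ.* fromℤ (f′ ℤ.+ + a ℤ.- + b)     ≡⟨ fromℤ-homo-* (+ k) _ ⟨
    fromℤ X                                        ≤⟨ i≤n*[⌊i/n⌋+1] X (k ∸ b) ⟩
    D ℚ.* (fromℤ (floor (X / (k ∸ b))) ℚ.+ 1ℚ)     ≡⟨ cong (λ x → D ℚ.* (fromℤ x ℚ.+ 1ℚ)) f≡⌊X/d⌋ ⟨
    D ℚ.* (F k ℚ.+ 1ℚ)                             ∎
    where
    open ℚP.≤-Reasoning
    f′ = f (k ∸ b) a b
    D = fromℤ (+ (k ∸ b))
    X = + k ℤ.* (f′ ℤ.+ + a ℤ.- + b)
    f≡⌊X/d⌋ : f k a b ≡ floor (X / (k ∸ b))
    f≡⌊X/d⌋ = f-step (>-nonZero⁻¹ b) 2b<k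
    F′+1+C≡F′+a-b : F (k ∸ b) ℚ.+ 1ℚ ℚ.+ C ≡ fromℤ (f′ ℤ.+ + a ℤ.- + b)
    F′+1+C≡F′+a-b = begin-equality
      fromℤ f′ ℚ.+ 1ℚ ℚ.+ C                 ≡⟨ cong (ℚ._+ C) (fromℤ-homo-+ f′ 1ℤ) ⟨
      fromℤ (f′ ℤ.+ 1ℤ) ℚ.+ C               ≡⟨ fromℤ-homo-+ (f′ ℤ.+ 1ℤ) c ⟨
      fromℤ (f′ ℤ.+ 1ℤ ℤ.+ c)               ≡⟨ cong fromℤ (solve 3 (λ f′ a b → f′ :+ con 1ℤ :+ (a :- b :- con 1ℤ)
                                                                         := f′ :+ a :- b) refl f′ (+ a) (+ b)) ⟩
      fromℤ (f′ ℤ.+ + a ℤ.- + b)            ∎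
      where open ℤS.+-*-Solver

  f-scaledBound : ∀ m k → b * suc m < k → k ≤ b * suc (suc m) →
                  scaledBound A B C (fromℤ (+ k)) (sumInv (suc m)) ℚ.≤ B ℚ.* F k
  f-scaledBound zero k b<k k≤2b =
    subst (λ x → scaledBound A B C K 0ℚ ℚ.≤ B ℚ.* x) KA≡F (scaledBound-zero A B C K {{fromℤ-nonNeg b}})
    where
    open ≡-Reasoning
    K = fromℤ (+ k)
    b*2≡b+b : b * 2 ≡ b ℕ.+ b
    b*2≡b+b = trans (*-suc b 1) (cong (b ℕ.+_) (*-identityʳ b))
    KA≡F : K ℚ.* A ≡ F k
    KA≡F = begin
      K ℚ.* A               ≡⟨ fromℤ-homo-* (+ k) (+ a) ⟨
      fromℤ (+ k ℤ.* + a)   ≡⟨ cong fromℤ (ℤP.pos-* k a) ⟨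
      fromℤ (+ (k * a))     ≡⟨ cong fromℤ (f-middle (subst (_< k) (*-identityʳ b) b<k) (subst (k ≤_) b*2≡b+b k≤2b)) ⟨
      F k                   ∎
  f-scaledBound (suc m) k b[2+m]<k k≤b[3+m] =
    subst (λ K → scaledBound A B C K (sumInv (suc (suc m))) ℚ.≤ B ℚ.* F k) (sym K≡D+B)
      (scaledBound-step A B C D (sumInv (suc m)) (+ 1 / suc (suc m)) (F k) (F d)
        {{fromℤ-pos d}} {{fromℤ-nonNeg b}} {{nonNegative (fromℤ-mono-≤ c≥0)}}
        (f-scaledBound m d b[1+m]<d d≤b[2+m])
        (subst (λ K → K ℚ.* (F d ℚ.+ 1ℚ ℚ.+ C) ℚ.≤ D ℚ.* (F k ℚ.+ 1ℚ)) K≡D+B (f-step-≤ k 2b<k))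
        (d≤b*n⇒d*[1/n]≤b d b (suc (suc m)) d≤b[2+m]))
    where
    d = k ∸ b
    D = fromℤ (+ d)
    b[1+m]<d : b * suc m < d
    b[1+m]<d = b*m<k∸b {b} b[2+m]<k
    d≤b[2+m] : d ≤ b * suc (suc m)
    d≤b[2+m] = k∸b≤b*m {b} k≤b[3+m]
    instance
      d≢0 : NonZero d
      d≢0 = >-nonZero (≤-<-trans z≤n b[1+m]<d)
    2b<k : b ℕ.+ b < k
    2b<k = ≤-<-trans (+-monoʳ-≤ b (m≤m*n b (suc m))) (subst (_< k) (*-suc b (suc m)) b[2+m]<k)
    K≡D+B : fromℤ (+ k) ≡ D ℚ.+ B
    K≡D+B = begin
      fromℤ (+ k)             ≡⟨ cong (λ n → fromℤ (+ n)) (m∸n+n≡m (<⇒≤ (≤-<-trans (m≤m+n b b) 2b<k))) ⟨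
      fromℤ (+ (d ℕ.+ b))     ≡⟨ cong fromℤ (ℤP.pos-+ d b) ⟩
      fromℤ (+ d ℤ.+ + b)     ≡⟨ fromℤ-homo-+ (+ d) (+ b) ⟩
      D ℚ.+ B                 ∎
      where open ≡-Reasoning

  f-bound : ∀ m k → b * suc m < k → k ≤ b * suc (suc m) →
            fromℤ (+ (k * a) ℤ.- 1ℤ) ℚ.+ ((+ k ℤ.* c) / b) ℚ.* sumInv (suc m) ℚ.≤ F k
  f-bound m k b[1+m]<k k≤b[2+m] =
    subst (λ x → x ℚ.+ E ℚ.* sumInv (suc m) ℚ.≤ F k) KA-1≡ka-1
      (scaledBound⇒bound A B C K E (sumInv (suc m)) (F k) {{fromℤ-pos b}} BE≡KC
        (f-scaledBound m k b[1+m]<k k≤b[2+m]))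
    where
    open ≡-Reasoning
    K = fromℤ (+ k)
    E = (+ k ℤ.* c) / b
    BE≡KC : B ℚ.* E ≡ K ℚ.* C
    BE≡KC = trans (n*[i/n]≡i (+ k ℤ.* c) b) (fromℤ-homo-* (+ k) c)
    KA-1≡ka-1 : K ℚ.* A ℚ.- 1ℚ ≡ fromℤ (+ (k * a) ℤ.- 1ℤ)
    KA-1≡ka-1 = begin
      K ℚ.* A ℚ.- 1ℚ                ≡⟨ cong (ℚ._- 1ℚ) (fromℤ-homo-* (+ k) (+ a)) ⟨
      fromℤ (+ k ℤ.* + a) ℚ.- 1ℚ    ≡⟨ fromℤ-homo-minus (+ k ℤ.* + a) 1ℤ ⟨
      fromℤ (+ k ℤ.* + a ℤ.- 1ℤ)    ≡⟨ cong (λ x → fromℤ (x ℤ.- 1ℤ)) (ℤP.pos-* k a) ⟨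
      fromℤ (+ (k * a) ℤ.- 1ℤ)      ∎

lemma2p1 : (a b k : ℕ) → 0 < a → (hb : 0 < b) → 0 < k → b < k → + 0 ℤ.≤ (+ a ℤ.- + b ℤ.- 1ℤ) →
    ((+ (k * a) ℤ.- 1ℤ) / 1)
      ℚ.+ ((+ k ℤ.* (+ a ℤ.- + b ℤ.- 1ℤ)) / b) {{>-nonZero hb}}
        ℚ.* sumInv ∣ ceiling (((+ k) / b) {{>-nonZero hb}}) ℤ.- 1ℤ ∣
      ℚ.≤ (f k a b / 1)
lemma2p1 a b k _ hb _ b<k c≥0 =
  let m , ⌈k/b⌉≡2+m , b[1+m]<k , k≤b[2+m] = ceiling-/-window b k b<k
  in subst (λ x → fromℤ (+ (k * a) ℤ.- 1ℤ) ℚ.+ ((+ k ℤ.* (+ a ℤ.- + b ℤ.- 1ℤ)) / b) ℚ.* sumInv ∣ x ℤ.- 1ℤ ∣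
                     ℚ.≤ fromℤ (f k a b))
           (sym ⌈k/b⌉≡2+m) (f-bound a b c≥0 m k b[1+m]<k k≤b[2+m])
  where
  instance
    b≢0 : NonZero b
    b≢0 = >-nonZero hb
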